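{- Let $G$ and $H$ be graphs with $\Delta(G)\geq 1$. Then $vs_{\Delta}(G\circ H)\leq vs_{\Delta}(G)$.
   Context: All graphs are finite and simple. The corona $G\circ H$ of $G$ (with $n$ vertices) and $H$ is obtained from one copy of $G$ and $n$ copies of $H$ by joining the $i$-th vertex of $G$ to every vertex of the $i$-th copy of $H$. $\Delta$ is the maximum degree. For a graph invariant $\rho$, the $\rho$-vertex stability number $vs_{\rho}(G)$ is the minimum number of vertices of $G$ whose removal results in a graph $H'\subseteq G$ with $\rho(H')\neq\rho(G)$ or with $E(H')=\emptyset$. -}

module Defs where

open import Data.Bool using (Bool; true; false; _∧_; _∨_; not; if_then_else_)
open import Data.Nat using (ℕ; zero; suc; _⊔_; _⊓_; _≡ᵇ_)
open import Data.Fin using (Fin; splitAt; remQuot; _≟_)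
open import Data.Fin.Subset using (Subset; inside; outside; ∣_∣; ∁; ⊤)
open import Data.List using (List; []; _∷_; map; foldr; allFin; _++_)
open import Data.Nat.ListAction using (sum)
open import Data.Bool.ListAction using (and)
open import Data.Vec using (lookup)
open import Data.Sum using (inj₁; inj₂)
open import Data.Product using (_,_; _×_)
open import Relation.Nullary.Decidable using (⌊_⌋)
open import Relation.Binary.PropositionalEquality using (_≡_)

record Graph : Set where
  field
    size : ℕ
    adj  : Fin size → Fin size → Bool
open Graph public

Simple : Graph → Set
Simple G = ((u v : Fin (size G)) → adj G u v ≡ adj G v u)
         × ((v : Fin (size G)) → adj G v v ≡ false)

-- Corona G ∘ H: vertices Fin (n + n * m); the first n are the vertices of G,
-- the remaining ones are pairs (i , a) = vertex a of the i-th copy of H.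
corona : Graph → Graph → Graph
corona G H = record { size = n Data.Nat.+ n Data.Nat.* m ; adj = A }
  where
  n = size G
  m = size H
  A : Fin (n Data.Nat.+ n Data.Nat.* m) → Fin (n Data.Nat.+ n Data.Nat.* m) → Bool
  A x y with splitAt n x | splitAt n y
  ... | inj₁ i | inj₁ j = adj G i j
  ... | inj₁ i | inj₂ q with remQuot {n} m q
  ...   | (j , b) = ⌊ i ≟ j ⌋
  A x y | inj₂ p | inj₁ j with remQuot {n} m p
  ...   | (i , a) = ⌊ i ≟ j ⌋
  A x y | inj₂ p | inj₂ q with remQuot {n} m p | remQuot {n} m q
  ...   | (i , a) | (j , b) = ⌊ i ≟ j ⌋ ∧ adj H a b

degIn : (G : Graph) → Subset (size G) → Fin (size G) → ℕ
degIn G R v = sum (map (λ u → if lookup R u ∧ adj G v u then 1 else 0) (allFin (size G)))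

maxDegIn : (G : Graph) → Subset (size G) → ℕ
maxDegIn G R = foldr _⊔_ 0 (map (λ v → if lookup R v then degIn G R v else 0) (allFin (size G)))

maxDeg : Graph → ℕ
maxDeg G = maxDegIn G ⊤

noEdgesIn : (G : Graph) → Subset (size G) → Bool
noEdgesIn G R = and (map (λ u → and (map (λ v → not (lookup R u ∧ lookup R v ∧ adj G u v))
                                         (allFin (size G))))
                         (allFin (size G)))

allSubsets : (n : ℕ) → List (Subset n)
allSubsets zero = Data.Vec.[] ∷ []
allSubsets (suc n) = map (inside Data.Vec.∷_) (allSubsets n) ++ map (outside Data.Vec.∷_) (allSubsets n)

-- Removing the set S of vertices from G gives G - S = G[∁ S]; S is "Δ-destabilising"
-- if Δ(G - S) ≠ Δ(G) or E(G - S) = ∅.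
destabilising : (G : Graph) → Subset (size G) → Bool
destabilising G S = not (maxDegIn G (∁ S) ≡ᵇ maxDeg G) ∨ noEdgesIn G (∁ S)

-- vs_Δ(G): minimum |S| over destabilising S. (Removing all vertices is always
-- destabilising, so the initial value size G of the fold is never the unique bound.)
vsΔ : Graph → ℕ
vsΔ G = foldr (λ S acc → if destabilising G S then ∣ S ∣ ⊓ acc else acc) (size G) (allSubsets (size G))

module Submission where

-- Write C = G ∘ H, n = |V(G)|, m = |V(H)|, and regard a set S of
-- vertices of G as a set of vertices of C.  In C − S
--   * a vertex v of G keeps its m pendant neighbours in the v-th copy of H,
--     so its degree is deg_{G−S}(v) + m;
--   * a vertex (i , a) of the i-th copy of H is adjacent to at most the base
--     vertex i and the neighbours of a in H, hence (H being loopless) has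
--     degree at most 1 + (m − 1) = m.
-- Therefore Δ(C − S) ≤ Δ(G − S) + m, while Δ(C) ≥ Δ(G) + m.  When Δ(G) ≥ 1,
-- S destabilises G exactly when Δ(G − S) < Δ(G) (an edgeless G − S has
-- maximum degree 0), so every such S also destabilises C, and
-- vs_Δ(C) ≤ |S|.

open import Defs
open import Data.Bool using (Bool; true; false; _∧_; _∨_; not; if_then_else_; T)
open import Data.Bool.Properties using (∨-zeroʳ; T-≡)
open import Data.Nat using (ℕ; zero; suc; _+_; _*_; _⊔_; _⊓_; _≡ᵇ_; _≤_; _<_; z≤n; s≤s)
open import Data.Nat.Properties
  using (≤-refl; ≤-trans; ≤-reflexive; ≤-total; +-assoc; +-identityʳ; +-mono-≤; +-mono-≤-<; +-monoˡ-≤; +-monoˡ-<; m≤n+m;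
         m≤m⊔n; m≤n⊔m; ⊔-lub; m⊓n≤m; m⊓n≤n; ⊓-glb; n≤0⇒n≡0; ≤∧≢⇒<; <⇒≢; ≡⇒≡ᵇ; _≟_; module ≤-Reasoning)
open import Data.Fin using (Fin; splitAt; remQuot; combine; join; _↑ˡ_; _↑ʳ_) renaming (_≟_ to _≟ᶠ_)
import Data.Fin as Fin
open import Data.Fin.Properties using (splitAt-↑ˡ; splitAt-↑ʳ; remQuot-combine; join-splitAt; combine-remQuot; suc-injective)
open import Data.Fin.Subset using (Subset; outside; ∣_∣; ∁; ⊤; ⊥)
open import Data.Fin.Subset.Properties using (∣⊤∣≡n; ∣⊥∣≡0)
open import Data.List using ([]; _∷_; foldr; tabulate; allFin)
open import Data.Bool.ListAction using (all)
open import Data.List.Properties using (map-tabulate)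
open import Data.List.Membership.Propositional using (_∈_)
open import Data.List.Membership.Propositional.Properties using (∈-++⁺ˡ; ∈-++⁺ʳ; ∈-map⁺; ∈-allFin)
open import Data.List.Relation.Unary.Any using (here; there)
import Data.List.Relation.Unary.All as All
open import Data.List.Relation.Unary.All.Properties using (all⁺; all⁻)
open import Data.Nat.ListAction using (sum)
import Data.Vec as Vec
open import Data.Vec using (lookup; replicate)
open import Data.Vec.Properties using (lookup-++ˡ; lookup-++ʳ; lookup-replicate; lookup-map; map-replicate)
open import Data.Sum using (inj₁; inj₂)
open import Data.Product using (_,_; _×_; ∃; proj₁; proj₂)
open import Function using (_∘_; Equivalence)
open import Relation.Nullary using (contradiction; yes; no)
open import Relation.Nullary.Decidable using (⌊_⌋; dec-false)
open import Relation.Binary.PropositionalEquality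

-- (1) Sums and maxima indexed by Fin N

indicator : Bool → ℕ
indicator b = if b then 1 else 0

indicator≤1 : ∀ b → indicator b ≤ 1
indicator≤1 true  = ≤-refl
indicator≤1 false = z≤n

indicator-∧ : ∀ a b → indicator (a ∧ b) ≤ indicator b
indicator-∧ true  b = ≤-refl
indicator-∧ false b = z≤n

sumFin : (N : ℕ) → (Fin N → ℕ) → ℕ
sumFin N f = sum (tabulate f)

sumFin-cong : ∀ N {f g : Fin N → ℕ} → (∀ x → f x ≡ g x) → sumFin N f ≡ sumFin N g
sumFin-cong zero    eq = refl
sumFin-cong (suc N) eq = cong₂ _+_ (eq Fin.zero) (sumFin-cong N (eq ∘ Fin.suc))

sumFin-mono : ∀ N {f g : Fin N → ℕ} → (∀ x → f x ≤ g x) → sumFin N f ≤ sumFin N g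
sumFin-mono zero    le = z≤n
sumFin-mono (suc N) le = +-mono-≤ (le Fin.zero) (sumFin-mono N (le ∘ Fin.suc))

sumFin-zero : ∀ N {f : Fin N → ℕ} → (∀ x → f x ≡ 0) → sumFin N f ≡ 0
sumFin-zero zero    eq = refl
sumFin-zero (suc N) eq = cong₂ _+_ (eq Fin.zero) (sumFin-zero N (eq ∘ Fin.suc))

sumFin-ones : ∀ N → sumFin N (λ _ → 1) ≡ N
sumFin-ones zero    = refl
sumFin-ones (suc N) = cong suc (sumFin-ones N)

sumFin-single : ∀ N (i : Fin N) (f : Fin N → ℕ) → (∀ j → i ≢ j → f j ≡ 0) → sumFin N f ≡ f i
sumFin-single (suc N) Fin.zero f off = begin
    f Fin.zero + sumFin N (f ∘ Fin.suc)
  ≡⟨ cong (f Fin.zero +_) (sumFin-zero N (λ j → off (Fin.suc j) (λ ()))) ⟩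
    f Fin.zero + 0
  ≡⟨ +-identityʳ _ ⟩
    f Fin.zero ∎
  where open ≡-Reasoning
sumFin-single (suc N) (Fin.suc i) f off = begin
    f Fin.zero + sumFin N (f ∘ Fin.suc)
  ≡⟨ cong₂ _+_ (off Fin.zero (λ ())) (sumFin-single N i (f ∘ Fin.suc) (λ j i≢j → off (Fin.suc j) (i≢j ∘ suc-injective))) ⟩
    f (Fin.suc i) ∎
  where open ≡-Reasoning

sumFin-+ : ∀ n k (f : Fin (n + k) → ℕ) →
  sumFin (n + k) f ≡ sumFin n (f ∘ (_↑ˡ k)) + sumFin k (f ∘ (n ↑ʳ_))
sumFin-+ zero    k f = refl
sumFin-+ (suc n) k f =
  trans (cong (f Fin.zero +_) (sumFin-+ n k (f ∘ Fin.suc))) (sym (+-assoc (f Fin.zero) _ _))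

sumFin-* : ∀ n m (f : Fin (n * m) → ℕ) →
  sumFin (n * m) f ≡ sumFin n (λ i → sumFin m (λ a → f (combine i a)))
sumFin-* zero    m f = refl
sumFin-* (suc n) m f =
  trans (sumFin-+ m (n * m) f) (cong (sumFin m (f ∘ (_↑ˡ (n * m))) +_) (sumFin-* n m (f ∘ (m ↑ʳ_))))

sumFin-count≤ : ∀ N (h : Fin N → Bool) → sumFin N (indicator ∘ h) ≤ N
sumFin-count≤ N h = ≤-trans (sumFin-mono N (indicator≤1 ∘ h)) (≤-reflexive (sumFin-ones N))

sumFin-count< : ∀ N (h : Fin N → Bool) a → h a ≡ false → sumFin N (indicator ∘ h) < N
sumFin-count< (suc N) h Fin.zero ha rewrite ha = s≤s (sumFin-count≤ N (h ∘ Fin.suc))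
sumFin-count< (suc N) h (Fin.suc a) ha =
  +-mono-≤-< (indicator≤1 (h Fin.zero)) (sumFin-count< N (h ∘ Fin.suc) a ha)

maxFin : (N : ℕ) → (Fin N → ℕ) → ℕ
maxFin N f = foldr _⊔_ 0 (tabulate f)

maxFin-ub : ∀ N (f : Fin N → ℕ) x → f x ≤ maxFin N f
maxFin-ub (suc N) f Fin.zero    = m≤m⊔n _ _
maxFin-ub (suc N) f (Fin.suc x) = ≤-trans (maxFin-ub N (f ∘ Fin.suc) x) (m≤n⊔m _ _)

maxFin-lub : ∀ N (f : Fin N → ℕ) K → (∀ x → f x ≤ K) → maxFin N f ≤ K
maxFin-lub zero    f K le = z≤n
maxFin-lub (suc N) f K le = ⊔-lub (le Fin.zero) (maxFin-lub N (f ∘ Fin.suc) K (le ∘ Fin.suc))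

maxFin-attained : ∀ N (f : Fin N → ℕ) → 1 ≤ maxFin N f → ∃ λ x → maxFin N f ≤ f x
maxFin-attained (suc N) f pos with ≤-total (f Fin.zero) (maxFin N (f ∘ Fin.suc))
... | inj₂ headMax = Fin.zero , ⊔-lub ≤-refl headMax
... | inj₁ tailMax with maxFin-attained N (f ∘ Fin.suc) (≤-trans pos (⊔-lub tailMax ≤-refl))
...   | x , le = Fin.suc x , ≤-trans (⊔-lub tailMax ≤-refl) le

-- (2) Degrees and maximum degrees of induced subgraphs

module _ (G : Graph) where

  degIn≡sumFin : ∀ R v → degIn G R v ≡ sumFin (size G) (λ u → indicator (lookup R u ∧ adj G v u))
  degIn≡sumFin R v = cong sum (map-tabulate (λ u → u) (λ u → indicator (lookup R u ∧ adj G v u)))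

  presentDeg : Subset (size G) → Fin (size G) → ℕ
  presentDeg R v = if lookup R v then degIn G R v else 0

  maxDegIn≡maxFin : ∀ R → maxDegIn G R ≡ maxFin (size G) (presentDeg R)
  maxDegIn≡maxFin R = cong (foldr _⊔_ 0) (map-tabulate (λ v → v) (presentDeg R))

  presentDeg-∈ : ∀ R v → lookup R v ≡ true → presentDeg R v ≡ degIn G R v
  presentDeg-∈ R v v∈R rewrite v∈R = refl

  degIn≤maxDegIn : ∀ R v → lookup R v ≡ true → degIn G R v ≤ maxDegIn G R
  degIn≤maxDegIn R v v∈R = subst₂ _≤_ (presentDeg-∈ R v v∈R) (sym (maxDegIn≡maxFin R))
    (maxFin-ub (size G) (presentDeg R) v)

  maxDegIn-lub : ∀ R K → (∀ v → lookup R v ≡ true → degIn G R v ≤ K) → maxDegIn G R ≤ K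
  maxDegIn-lub R K bound = subst (_≤ K) (sym (maxDegIn≡maxFin R))
    (maxFin-lub (size G) (presentDeg R) K presentBound)
    where
    presentBound : ∀ v → presentDeg R v ≤ K
    presentBound v with lookup R v in v∈R
    ... | true  = bound v v∈R
    ... | false = z≤n

  maxDegIn-attained : ∀ R → 1 ≤ maxDegIn G R → ∃ λ v → lookup R v ≡ true × maxDegIn G R ≤ degIn G R v
  maxDegIn-attained R pos
    with maxFin-attained (size G) (presentDeg R) (subst (1 ≤_) (maxDegIn≡maxFin R) pos)
  ... | v , le with lookup R v in v∈R
  ...   | true  = v , v∈R , subst (_≤ degIn G R v) (sym (maxDegIn≡maxFin R)) le
  ...   | false = contradiction (≤-trans pos (subst (_≤ 0) (sym (maxDegIn≡maxFin R)) le)) λ ()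

  maxDegIn≤maxDeg : ∀ R → maxDegIn G R ≤ maxDeg G
  maxDegIn≤maxDeg R = maxDegIn-lub R (maxDeg G) λ v _ → begin
      degIn G R v
    ≡⟨ degIn≡sumFin R v ⟩
      sumFin (size G) (λ u → indicator (lookup R u ∧ adj G v u))
    ≤⟨ sumFin-mono (size G) (λ u → subst (λ b → indicator (lookup R u ∧ adj G v u) ≤ indicator (b ∧ adj G v u))
                                          (sym (lookup-replicate u true)) (indicator-∧ (lookup R u) _)) ⟩
      sumFin (size G) (λ u → indicator (lookup ⊤ u ∧ adj G v u))
    ≡⟨ sym (degIn≡sumFin ⊤ v) ⟩
      degIn G ⊤ v
    ≤⟨ degIn≤maxDegIn ⊤ v (lookup-replicate v true) ⟩
      maxDeg G ∎
    where open ≤-Reasoning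

  nonEdge : Subset (size G) → Fin (size G) → Fin (size G) → Bool
  nonEdge R u v = not (lookup R u ∧ lookup R v ∧ adj G u v)

  nonEdgeRow : Subset (size G) → Fin (size G) → Bool
  nonEdgeRow R u = all (nonEdge R u) (allFin (size G))

  noEdgesIn-intro : ∀ R → (∀ u v → (lookup R u ∧ lookup R v ∧ adj G u v) ≡ false) → noEdgesIn G R ≡ true
  noEdgesIn-intro R none = Equivalence.to T-≡
    (all⁻ (nonEdgeRow R) {xs = allFin (size G)} (All.tabulate λ {u} _ →
      all⁻ (nonEdge R u) {xs = allFin (size G)} (All.tabulate λ {v} _ →
        Equivalence.from T-≡ (cong not (none u v)))))

  noEdgesIn-elim : ∀ R → noEdgesIn G R ≡ true → ∀ u v → (lookup R u ∧ lookup R v ∧ adj G u v) ≡ false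
  noEdgesIn-elim R edgeless u v = not-injective (Equivalence.to T-≡ (All.lookup rowU (∈-allFin v)))
    where
    rowU : All.All (T ∘ nonEdge R u) (allFin (size G))
    rowU = all⁺ (nonEdge R u) _
      (All.lookup (all⁺ (nonEdgeRow R) _ (Equivalence.from T-≡ edgeless)) (∈-allFin u))
    not-injective : ∀ {b} → not b ≡ true → b ≡ false
    not-injective {false} refl = refl

  edgeless⇒maxDegIn≡0 : ∀ R → noEdgesIn G R ≡ true → maxDegIn G R ≡ 0
  edgeless⇒maxDegIn≡0 R edgeless = n≤0⇒n≡0 (maxDegIn-lub R 0 λ v v∈R →
    ≤-reflexive (trans (degIn≡sumFin R v) (sumFin-zero (size G) λ u →
      cong indicator (subst (λ b → (b ∧ lookup R u ∧ adj G v u) ≡ false) v∈R (noEdgesIn-elim R edgeless v u)))))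

  -- Removing every vertex is destabilising; this makes vs_Δ a genuine minimum.
  removeAll-destabilising : destabilising G ⊤ ≡ true
  removeAll-destabilising = trans (cong (not (maxDegIn G (∁ ⊤) ≡ᵇ maxDeg G) ∨_) edgeless) (∨-zeroʳ _)
    where
    ∁⊤≡⊥ : ∁ ⊤ ≡ ⊥ {size G}
    ∁⊤≡⊥ = map-replicate not true (size G)
    edgeless : noEdgesIn G (∁ ⊤) ≡ true
    edgeless = noEdgesIn-intro (∁ ⊤) λ u v →
      trans (cong (λ R → lookup R u ∧ lookup R v ∧ adj G u v) ∁⊤≡⊥)
            (cong (λ b → b ∧ lookup ⊥ v ∧ adj G u v) (lookup-replicate u false))

  destabilising⇒drop : 1 ≤ maxDeg G → ∀ S → destabilising G S ≡ true → maxDegIn G (∁ S) < maxDeg G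
  destabilising⇒drop pos S destab with maxDegIn G (∁ S) ≡ᵇ maxDeg G in same
  ... | false = ≤∧≢⇒< (maxDegIn≤maxDeg (∁ S)) λ eq → subst T same (≡⇒≡ᵇ _ _ eq)
  ... | true  = subst (_< maxDeg G) (sym (edgeless⇒maxDegIn≡0 (∁ S) destab)) pos

  drop⇒destabilising : ∀ S → maxDegIn G (∁ S) < maxDeg G → destabilising G S ≡ true
  drop⇒destabilising S lt = subst (λ b → not b ∨ noEdgesIn G (∁ S) ≡ true) (sym Δchanged) refl
    where
    Δchanged : (maxDegIn G (∁ S) ≡ᵇ maxDeg G) ≡ false
    Δchanged = dec-false (maxDegIn G (∁ S) ≟ maxDeg G) (<⇒≢ lt)

-- (3) vs_Δ is the minimum size of a destabilising set

allSubsets-complete : ∀ n (S : Subset n) → S ∈ allSubsets n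
allSubsets-complete zero    Vec.[]          = here refl
allSubsets-complete (suc n) (true  Vec.∷ S) = ∈-++⁺ˡ (∈-map⁺ (true Vec.∷_) (allSubsets-complete n S))
allSubsets-complete (suc n) (false Vec.∷ S) = ∈-++⁺ʳ _ (∈-map⁺ (false Vec.∷_) (allSubsets-complete n S))

module _ (G : Graph) where

  minStep : Subset (size G) → ℕ → ℕ
  minStep S acc = if destabilising G S then ∣ S ∣ ⊓ acc else acc

  minOver-≤ : ∀ l S → S ∈ l → destabilising G S ≡ true → foldr minStep (size G) l ≤ ∣ S ∣
  minOver-≤ (S ∷ l) S (here refl) destab rewrite destab = m⊓n≤m _ _
  minOver-≤ (S′ ∷ l) S (there S∈l) destab with destabilising G S′
  ... | true  = ≤-trans (m⊓n≤n _ _) (minOver-≤ l S S∈l destab)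
  ... | false = minOver-≤ l S S∈l destab

  minOver-glb : ∀ c l → c ≤ size G → (∀ S → destabilising G S ≡ true → c ≤ ∣ S ∣) → c ≤ foldr minStep (size G) l
  minOver-glb c []      c≤n bound = c≤n
  minOver-glb c (S ∷ l) c≤n bound with destabilising G S in destab
  ... | true  = ⊓-glb (bound S destab) (minOver-glb c l c≤n bound)
  ... | false = minOver-glb c l c≤n bound

  vsΔ≤ : ∀ S → destabilising G S ≡ true → vsΔ G ≤ ∣ S ∣
  vsΔ≤ S = minOver-≤ (allSubsets (size G)) S (allSubsets-complete (size G) S)

  ≤vsΔ : ∀ c → (∀ S → destabilising G S ≡ true → c ≤ ∣ S ∣) → c ≤ vsΔ G
  ≤vsΔ c bound = minOver-glb c (allSubsets (size G))
    (subst (c ≤_) (∣⊤∣≡n (size G)) (bound ⊤ (removeAll-destabilising G))) bound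

-- (4) Degrees in the corona G ∘ H

module Corona (G H : Graph) where

  n : ℕ
  n = size G

  m : ℕ
  m = size H

  C : Graph
  C = corona G H

  base : Fin n → Fin (size C)
  base i = i ↑ˡ (n * m)

  copy : Fin n → Fin m → Fin (size C)
  copy i a = n ↑ʳ combine i a

  data CoronaVertex : Fin (size C) → Set where
    isBase : ∀ i → CoronaVertex (base i)
    isCopy : ∀ i a → CoronaVertex (copy i a)

  coronaVertex : ∀ x → CoronaVertex x
  coronaVertex x = subst CoronaVertex (join-splitAt n (n * m) x) (fromSplit (splitAt n x))
    where
    fromSplit : ∀ s → CoronaVertex (join n (n * m) s)
    fromSplit (inj₁ i) = isBase i
    fromSplit (inj₂ y) = subst (CoronaVertex ∘ (n ↑ʳ_)) (combine-remQuot {n} m y)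
                               (isCopy (proj₁ (remQuot {n} m y)) (proj₂ (remQuot {n} m y)))

  sumFin-corona : ∀ f → sumFin (size C) f ≡ sumFin n (f ∘ base) + sumFin n (λ j → sumFin m (f ∘ copy j))
  sumFin-corona f = trans (sumFin-+ n (n * m) f) (cong (sumFin n (f ∘ base) +_) (sumFin-* n m (f ∘ (n ↑ʳ_))))

  ⌊≟⌋-true : ∀ (i : Fin n) → ⌊ i ≟ᶠ i ⌋ ≡ true
  ⌊≟⌋-true i with i ≟ᶠ i
  ... | yes _   = refl
  ... | no  i≢i = contradiction refl i≢i

  ⌊≟⌋-false : ∀ {i j : Fin n} → i ≢ j → ⌊ i ≟ᶠ j ⌋ ≡ false
  ⌊≟⌋-false {i} {j} i≢j with i ≟ᶠ j
  ... | yes i≡j = contradiction i≡j i≢j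
  ... | no  _   = refl

  adj-base-base : ∀ i j → adj C (base i) (base j) ≡ adj G i j
  adj-base-base i j rewrite splitAt-↑ˡ n i (n * m) | splitAt-↑ˡ n j (n * m) = refl

  adj-base-copy : ∀ i j b → adj C (base i) (copy j b) ≡ ⌊ i ≟ᶠ j ⌋
  adj-base-copy i j b rewrite splitAt-↑ˡ n i (n * m) | splitAt-↑ʳ n (n * m) (combine j b) =
    cong (λ p → ⌊ i ≟ᶠ proj₁ p ⌋) (remQuot-combine {n} {m} j b)

  adj-copy-base : ∀ i a j → adj C (copy i a) (base j) ≡ ⌊ i ≟ᶠ j ⌋
  adj-copy-base i a j rewrite splitAt-↑ˡ n j (n * m) | splitAt-↑ʳ n (n * m) (combine i a) =
    cong (λ p → ⌊ proj₁ p ≟ᶠ j ⌋) (remQuot-combine {n} {m} i a)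

  adj-copy-copy : ∀ i a j b → adj C (copy i a) (copy j b) ≡ ⌊ i ≟ᶠ j ⌋ ∧ adj H a b
  adj-copy-copy i a j b rewrite splitAt-↑ʳ n (n * m) (combine i a) | splitAt-↑ʳ n (n * m) (combine j b) =
    cong₂ (λ p q → ⌊ proj₁ p ≟ᶠ proj₁ q ⌋ ∧ adj H (proj₂ p) (proj₂ q))
          (remQuot-combine {n} {m} i a) (remQuot-combine {n} {m} j b)

  baseDegree : ∀ Q R → (∀ u → lookup Q (base u) ≡ lookup R u) → (∀ j b → lookup Q (copy j b) ≡ true) →
    ∀ i → degIn C Q (base i) ≡ degIn G R i + m
  baseDegree Q R onBase onCopies i = begin
      degIn C Q (base i)
    ≡⟨ trans (degIn≡sumFin C Q (base i)) (sumFin-corona _) ⟩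
      sumFin n (λ u → indicator (lookup Q (base u) ∧ adj C (base i) (base u)))
        + sumFin n (λ j → sumFin m (λ b → indicator (lookup Q (copy j b) ∧ adj C (base i) (copy j b))))
    ≡⟨ cong₂ _+_ (trans (sumFin-cong n baseTerm) (sym (degIn≡sumFin G R i)))
                 (sumFin-single n i _ λ j i≢j → sumFin-zero m λ b → otherCopy j i≢j b) ⟩
      degIn G R i + sumFin m (λ b → indicator (lookup Q (copy i b) ∧ adj C (base i) (copy i b)))
    ≡⟨ cong (degIn G R i +_) (trans (sumFin-cong m ownCopy) (sumFin-ones m)) ⟩
      degIn G R i + m ∎
    where
    open ≡-Reasoning
    baseTerm : ∀ u → indicator (lookup Q (base u) ∧ adj C (base i) (base u)) ≡ indicator (lookup R u ∧ adj G i u)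
    baseTerm u rewrite onBase u | adj-base-base i u = refl
    otherCopy : ∀ j → i ≢ j → ∀ b → indicator (lookup Q (copy j b) ∧ adj C (base i) (copy j b)) ≡ 0
    otherCopy j i≢j b rewrite adj-base-copy i j b | ⌊≟⌋-false i≢j | onCopies j b = refl
    ownCopy : ∀ b → indicator (lookup Q (copy i b) ∧ adj C (base i) (copy i b)) ≡ 1
    ownCopy b rewrite adj-base-copy i i b | ⌊≟⌋-true i | onCopies i b = refl

  copyDegree : Simple H → ∀ Q i a → degIn C Q (copy i a) ≤ m
  copyDegree simpleH Q i a = begin
      degIn C Q (copy i a)
    ≡⟨ trans (degIn≡sumFin C Q (copy i a)) (sumFin-corona _) ⟩
      sumFin n (λ u → indicator (lookup Q (base u) ∧ adj C (copy i a) (base u)))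
        + sumFin n (λ j → sumFin m (λ b → indicator (lookup Q (copy j b) ∧ adj C (copy i a) (copy j b))))
    ≡⟨ cong₂ _+_ (sumFin-single n i _ λ u i≢u → otherBase u i≢u)
                 (sumFin-single n i _ λ j i≢j → sumFin-zero m λ b → otherCopy j i≢j b) ⟩
      indicator (lookup Q (base i) ∧ adj C (copy i a) (base i))
        + sumFin m (λ b → indicator (lookup Q (copy i b) ∧ adj C (copy i a) (copy i b)))
    ≤⟨ +-mono-≤ (indicator≤1 _) (sumFin-mono m ownCopy) ⟩
      suc (sumFin m (indicator ∘ adj H a))
    ≤⟨ sumFin-count< m (adj H a) a (proj₂ simpleH a) ⟩
      m ∎
    where
    open ≤-Reasoning
    otherBase : ∀ u → i ≢ u → indicator (lookup Q (base u) ∧ adj C (copy i a) (base u)) ≡ 0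
    otherBase u i≢u rewrite adj-copy-base i a u | ⌊≟⌋-false i≢u with lookup Q (base u)
    ... | true  = refl
    ... | false = refl
    otherCopy : ∀ j → i ≢ j → ∀ b → indicator (lookup Q (copy j b) ∧ adj C (copy i a) (copy j b)) ≡ 0
    otherCopy j i≢j b rewrite adj-copy-copy i a j b | ⌊≟⌋-false i≢j with lookup Q (copy j b)
    ... | true  = refl
    ... | false = refl
    ownCopy : ∀ b → indicator (lookup Q (copy i b) ∧ adj C (copy i a) (copy i b)) ≤ indicator (adj H a b)
    ownCopy b rewrite adj-copy-copy i a i b | ⌊≟⌋-true i = indicator-∧ (lookup Q (copy i b)) _

  -- Δ(C) ≥ Δ(G) + m: a vertex of maximum degree in G gains its m pendant neighbours.
  maxDeg-corona : 1 ≤ maxDeg G → maxDeg G + m ≤ maxDeg C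
  maxDeg-corona pos with maxDegIn-attained G ⊤ pos
  ... | v , _ , maxAtV = begin
      maxDeg G + m
    ≤⟨ +-monoˡ-≤ m maxAtV ⟩
      degIn G ⊤ v + m
    ≡⟨ sym (baseDegree ⊤ ⊤ (λ u → trans (inAll (base u)) (sym (inAll u))) (λ j b → inAll (copy j b)) v) ⟩
      degIn C ⊤ (base v)
    ≤⟨ degIn≤maxDegIn C ⊤ (base v) (inAll (base v)) ⟩
      maxDeg C ∎
    where
    open ≤-Reasoning
    inAll : ∀ {N} (x : Fin N) → lookup ⊤ x ≡ true
    inAll x = lookup-replicate x true

  liftBase : Subset n → Subset (size C)
  liftBase S = S Vec.++ replicate (n * m) outside

  ∣liftBase∣ : ∀ {k} (S : Subset k) → ∣ S Vec.++ replicate (n * m) outside ∣ ≡ ∣ S ∣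
  ∣liftBase∣ Vec.[]            = ∣⊥∣≡0 (n * m)
  ∣liftBase∣ (true  Vec.∷ S) = cong suc (∣liftBase∣ S)
  ∣liftBase∣ (false Vec.∷ S) = ∣liftBase∣ S

  remaining-base : ∀ S u → lookup (∁ (liftBase S)) (base u) ≡ lookup (∁ S) u
  remaining-base S u = begin
      lookup (∁ (liftBase S)) (base u)  ≡⟨ lookup-map (base u) not (liftBase S) ⟩
      not (lookup (liftBase S) (base u)) ≡⟨ cong not (lookup-++ˡ S _ u) ⟩
      not (lookup S u)                   ≡⟨ lookup-map u not S ⟨
      lookup (∁ S) u ∎
    where open ≡-Reasoning

  remaining-copy : ∀ S j b → lookup (∁ (liftBase S)) (copy j b) ≡ true
  remaining-copy S j b = trans (lookup-map (copy j b) not (liftBase S))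
    (cong not (trans (lookup-++ʳ S _ (combine j b)) (lookup-replicate (combine j b) outside)))

  maxDeg-corona-removed : Simple H → ∀ S → maxDegIn C (∁ (liftBase S)) ≤ maxDegIn G (∁ S) + m
  maxDeg-corona-removed simpleH S = maxDegIn-lub C (∁ (liftBase S)) _ bound
    where
    bound : ∀ x → lookup (∁ (liftBase S)) x ≡ true → degIn C (∁ (liftBase S)) x ≤ maxDegIn G (∁ S) + m
    bound x present with coronaVertex x
    ... | isBase i = begin
        degIn C (∁ (liftBase S)) (base i)
      ≡⟨ baseDegree (∁ (liftBase S)) (∁ S) (remaining-base S) (remaining-copy S) i ⟩
        degIn G (∁ S) i + m
      ≤⟨ +-monoˡ-≤ m (degIn≤maxDegIn G (∁ S) i (trans (sym (remaining-base S i)) present)) ⟩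
        maxDegIn G (∁ S) + m ∎
      where open ≤-Reasoning
    ... | isCopy i a = ≤-trans (copyDegree simpleH (∁ (liftBase S)) i a) (m≤n+m m _)

  destabilising-lifts : Simple H → 1 ≤ maxDeg G → ∀ S → destabilising G S ≡ true → destabilising C (liftBase S) ≡ true
  destabilising-lifts simpleH pos S destab = drop⇒destabilising C (liftBase S) (begin-strict
      maxDegIn C (∁ (liftBase S))
    ≤⟨ maxDeg-corona-removed simpleH S ⟩
      maxDegIn G (∁ S) + m
    <⟨ +-monoˡ-< m (destabilising⇒drop G pos S destab) ⟩
      maxDeg G + m
    ≤⟨ maxDeg-corona pos ⟩
      maxDeg C ∎)
    where open ≤-Reasoning

-- (5) The theorem: every destabilising set of G lifts to one of G ∘ H of the
-- same size.  (Only H needs to be simple: its looplessness bounds copy degrees.)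

mainTheorem14 : (G H : Graph) → Simple G → Simple H → 1 ≤ maxDeg G
    → vsΔ (corona G H) ≤ vsΔ G
mainTheorem14 G H _ simpleH pos = ≤vsΔ G (vsΔ C) λ S destab → begin
    vsΔ C             ≤⟨ vsΔ≤ C (liftBase S) (destabilising-lifts simpleH pos S destab) ⟩
    ∣ liftBase S ∣    ≡⟨ ∣liftBase∣ S ⟩
    ∣ S ∣             ∎
  where
  open Corona G H
  open ≤-Reasoning
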